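{- Let $\mathcal R$ be an ordered commutative ring. Let $\alpha,\beta,\gamma,\delta$ be $2\times2$ matrices over $\mathcal R$ with determinant $1$ and all entries non-negative, and suppose $\alpha\beta=\gamma\delta$. Then both entries on the diagonal of $\gamma^{ -1}\alpha$ are positive. -}

module Defs where

open import Level using (Level; _⊔_; suc)
open import Algebra.Bundles using (CommutativeRing)
open import Relation.Binary.Core using (Rel)
open import Relation.Binary.Structures using (IsTotalOrder)
open import Relation.Nullary using (¬_)
open import Data.Product using (_×_)

record OrderedCommutativeRing (c ℓ₁ ℓ₂ : Level) : Set (suc (c ⊔ ℓ₁ ⊔ ℓ₂)) where
  field
    commutativeRing : CommutativeRing c ℓ₁
  open CommutativeRing commutativeRing public
  field
    _≤_          : Rel Carrier ℓ₂
    isTotalOrder : IsTotalOrder _≈_ _≤_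
    +-mono-≤     : ∀ {x y} z → x ≤ y → (x + z) ≤ (y + z)
    *-nonneg     : ∀ {x y} → 0# ≤ x → 0# ≤ y → 0# ≤ (x * y)
    nontrivial   : ¬ (0# ≈ 1#)

  _<_ : Rel Carrier (ℓ₁ ⊔ ℓ₂)
  x < y = (x ≤ y) × ¬ (x ≈ y)

module Mat2 {c ℓ₁ ℓ₂} (R : OrderedCommutativeRing c ℓ₁ ℓ₂) where
  open OrderedCommutativeRing R

  record M2 : Set c where
    constructor mat
    field
      a11 a12 a21 a22 : Carrier
  open M2 public

  _·_ : M2 → M2 → M2
  A · B = mat (a11 A * a11 B + a12 A * a21 B) (a11 A * a12 B + a12 A * a22 B)
              (a21 A * a11 B + a22 A * a21 B) (a21 A * a12 B + a22 A * a22 B)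

  det : M2 → Carrier
  det A = a11 A * a22 A - a12 A * a21 A

  _≋_ : M2 → M2 → Set ℓ₁
  A ≋ B = (a11 A ≈ a11 B) × (a12 A ≈ a12 B) × (a21 A ≈ a21 B) × (a22 A ≈ a22 B)

  NonNeg : M2 → Set ℓ₂
  NonNeg A = (0# ≤ a11 A) × (0# ≤ a12 A) × (0# ≤ a21 A) × (0# ≤ a22 A)

  -- adjugate; this is the inverse of any matrix with determinant 1
  adj : M2 → M2
  adj A = mat (a22 A) (- a12 A) (- a21 A) (a11 A)

-- Put M = γ⁻¹α = adj γ · α; then δ = Mβ and γ = α · adj M. For every 2×2 matrix M one has
-- E₁₁M + (adj M)E₂₂ = m₁₁I, hence αE₁₁δ + γE₂₂β = m₁₁αβ. If m₁₁ ≤ 0, the left-hand side is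
-- non-negative and the right-hand side non-positive, so α₁₁δ₁ⱼ = 0 for j = 1, 2. As the first
-- row of δ is unimodular this forces α₁₁ = 0, and then det α = -α₁₂α₂₁ ≤ 0, contradicting
-- det α = 1. Finally m₂₂ is the first diagonal entry of M⁻¹ = α⁻¹γ, which is the same situation
-- with (α, β) and (γ, δ) exchanged.
module Submission where

open import Data.Maybe using (Maybe; just; nothing)
open import Data.Nat.Base as ℕ using (zero; suc)
import Data.Nat.Properties as ℕₚ
open import Data.Integer.Base as ℤ using (ℤ; +_; -[1+_])
import Data.Integer.Properties as ℤₚ
import Data.Sign.Base as Sign
open import Data.Product using (_×_; _,_; proj₁; proj₂)
open import Data.Sum using (inj₁; inj₂)
open import Relation.Nullary using (¬_; yes; no; contradiction)
open import Relation.Binary.Bundles using (Poset; Setoid)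
open import Relation.Binary.Structures using (IsTotalOrder; IsEquivalence)
import Relation.Binary.PropositionalEquality as ≡
import Relation.Binary.Construct.NonStrictToStrict as NonStrictToStrict
import Relation.Binary.Reasoning.PartialOrder as PosetReasoning
import Relation.Binary.Reasoning.Setoid as SetoidReasoning
open import Algebra.Bundles using (CommutativeRing)
import Algebra.Properties.Ring as RingProperties
import Algebra.Properties.AbelianGroup as AbelianGroupProperties
import Algebra.Properties.Semiring.Mult as SemiringMultiplication
open import Algebra.Solver.Ring.AlmostCommutativeRing
  using (fromCommutativeRing; _-Raw-AlmostCommutative⟶_)
import Algebra.Solver.Ring as RingSolver
open import Defs

-- Over an abstract ring the solver needs coefficients whose arithmetic computes; ℤ maps into
-- every commutative ring.
module IntegerCoefficients {c ℓ} (CR : CommutativeRing c ℓ) where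

  open CommutativeRing CR
  open RingProperties ring using (-0#≈0#; -‿involutive; -‿distribˡ-*; -‿distribʳ-*)
  open AbelianGroupProperties +-abelianGroup using (⁻¹-∙-comm)
  open SemiringMultiplication semiring using (×-homo-+; ×1-homo-*) renaming (_×_ to _×ₙ_)
  open SetoidReasoning setoid

  ⟦_⟧ : ℤ → Carrier
  ⟦ + n ⟧      = n ×ₙ 1#
  ⟦ -[1+ n ] ⟧ = - (suc n ×ₙ 1#)

  private
    1+a-[1+b]≈a-b : ∀ a b → (1# + a) - (1# + b) ≈ a - b
    1+a-[1+b]≈a-b a b = begin
      (1# + a) - (1# + b)      ≈⟨ +-congˡ (⁻¹-∙-comm 1# b) ⟨
      (1# + a) + (- 1# + - b)  ≈⟨ +-congʳ (+-comm 1# a) ⟩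
      (a + 1#) + (- 1# + - b)  ≈⟨ +-assoc a 1# _ ⟩
      a + (1# + (- 1# + - b))  ≈⟨ +-congˡ (+-assoc 1# (- 1#) (- b)) ⟨
      a + ((1# - 1#) + - b)    ≈⟨ +-congˡ (+-congʳ (-‿inverseʳ 1#)) ⟩
      a + (0# + - b)           ≈⟨ +-congˡ (+-identityˡ (- b)) ⟩
      a - b                    ∎

    ⟦⊖⟧ : ∀ m n → ⟦ m ℤ.⊖ n ⟧ ≈ m ×ₙ 1# - n ×ₙ 1#
    ⟦⊖⟧ zero    zero    = sym (trans (+-identityˡ (- 0#)) -0#≈0#)
    ⟦⊖⟧ zero    (suc n) = sym (+-identityˡ _)
    ⟦⊖⟧ (suc m) zero    = sym (trans (+-congˡ -0#≈0#) (+-identityʳ _))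
    ⟦⊖⟧ (suc m) (suc n) = begin
      ⟦ suc m ℤ.⊖ suc n ⟧        ≡⟨ ≡.cong ⟦_⟧ (ℤₚ.[1+m]⊖[1+n]≡m⊖n m n) ⟩
      ⟦ m ℤ.⊖ n ⟧                ≈⟨ ⟦⊖⟧ m n ⟩
      m ×ₙ 1# - n ×ₙ 1#          ≈⟨ 1+a-[1+b]≈a-b _ _ ⟨
      suc m ×ₙ 1# - suc n ×ₙ 1#  ∎

  +-homo : ∀ i j → ⟦ i ℤ.+ j ⟧ ≈ ⟦ i ⟧ + ⟦ j ⟧
  +-homo (+ m)    (+ n)    = ×-homo-+ 1# m n
  +-homo (+ m)    -[1+ n ] = ⟦⊖⟧ m (suc n)
  +-homo -[1+ m ] (+ n)    = trans (⟦⊖⟧ n (suc m)) (+-comm _ _)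
  +-homo -[1+ m ] -[1+ n ] = begin
    - (suc (suc (m ℕ.+ n)) ×ₙ 1#)      ≡⟨ ≡.cong (λ k → - (k ×ₙ 1#)) (ℕₚ.+-suc (suc m) n) ⟨
    - ((suc m ℕ.+ suc n) ×ₙ 1#)        ≈⟨ -‿cong (×-homo-+ 1# (suc m) (suc n)) ⟩
    - (suc m ×ₙ 1# + suc n ×ₙ 1#)      ≈⟨ ⁻¹-∙-comm _ _ ⟨
    - (suc m ×ₙ 1#) + - (suc n ×ₙ 1#)  ∎

  -‿homo : ∀ i → ⟦ ℤ.- i ⟧ ≈ - ⟦ i ⟧
  -‿homo (+ zero)  = sym -0#≈0#
  -‿homo (+ suc n) = refl
  -‿homo -[1+ n ]  = sym (-‿involutive _)

  *-homo : ∀ i j → ⟦ i ℤ.* j ⟧ ≈ ⟦ i ⟧ * ⟦ j ⟧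
  *-homo (+ m) (+ n) = begin
    ⟦ Sign.+ ℤ.◃ m ℕ.* n ⟧           ≡⟨ ≡.cong ⟦_⟧ (ℤₚ.+◃n≡+n (m ℕ.* n)) ⟩
    ⟦ + (m ℕ.* n) ⟧                 ≈⟨ ×1-homo-* m n ⟩
    ⟦ + m ⟧ * ⟦ + n ⟧               ∎
  *-homo (+ m) -[1+ n ] = begin
    ⟦ Sign.- ℤ.◃ m ℕ.* suc n ⟧       ≡⟨ ≡.cong ⟦_⟧ (ℤₚ.-◃n≡-n (m ℕ.* suc n)) ⟩
    ⟦ ℤ.- (+ (m ℕ.* suc n)) ⟧       ≈⟨ -‿homo (+ (m ℕ.* suc n)) ⟩
    - ⟦ + (m ℕ.* suc n) ⟧           ≈⟨ -‿cong (×1-homo-* m (suc n)) ⟩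
    - (⟦ + m ⟧ * ⟦ + suc n ⟧)       ≈⟨ -‿distribʳ-* _ _ ⟩
    ⟦ + m ⟧ * ⟦ -[1+ n ] ⟧          ∎
  *-homo -[1+ m ] (+ n) = begin
    ⟦ Sign.- ℤ.◃ suc m ℕ.* n ⟧       ≡⟨ ≡.cong ⟦_⟧ (ℤₚ.-◃n≡-n (suc m ℕ.* n)) ⟩
    ⟦ ℤ.- (+ (suc m ℕ.* n)) ⟧       ≈⟨ -‿homo (+ (suc m ℕ.* n)) ⟩
    - ⟦ + (suc m ℕ.* n) ⟧           ≈⟨ -‿cong (×1-homo-* (suc m) n) ⟩
    - (⟦ + suc m ⟧ * ⟦ + n ⟧)       ≈⟨ -‿distribˡ-* _ _ ⟩
    ⟦ -[1+ m ] ⟧ * ⟦ + n ⟧          ∎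
  *-homo -[1+ m ] -[1+ n ] = begin
    ⟦ Sign.+ ℤ.◃ suc m ℕ.* suc n ⟧   ≡⟨ ≡.cong ⟦_⟧ (ℤₚ.+◃n≡+n (suc m ℕ.* suc n)) ⟩
    ⟦ + (suc m ℕ.* suc n) ⟧         ≈⟨ ×1-homo-* (suc m) (suc n) ⟩
    ⟦ + suc m ⟧ * ⟦ + suc n ⟧       ≈⟨ -‿involutive _ ⟨
    - - (⟦ + suc m ⟧ * ⟦ + suc n ⟧) ≈⟨ -‿cong (-‿distribʳ-* _ _) ⟩
    - (⟦ + suc m ⟧ * ⟦ -[1+ n ] ⟧)  ≈⟨ -‿distribˡ-* _ _ ⟩
    ⟦ -[1+ m ] ⟧ * ⟦ -[1+ n ] ⟧     ∎

  homomorphism : ℤ.+-*-rawRing -Raw-AlmostCommutative⟶ fromCommutativeRing CR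
  homomorphism = record
    { ⟦_⟧    = ⟦_⟧
    ; +-homo = +-homo
    ; *-homo = *-homo
    ; -‿homo = -‿homo
    ; 0-homo = refl
    ; 1-homo = +-identityʳ 1#
    }

  _coeff≟_ : ∀ i j → Maybe (⟦ i ⟧ ≈ ⟦ j ⟧)
  i coeff≟ j with i ℤₚ.≟ j
  ... | yes ≡.refl = just refl
  ... | no _       = nothing

  open RingSolver ℤ.+-*-rawRing (fromCommutativeRing CR) homomorphism _coeff≟_ public
    using (solve; _:=_; _:+_; _:*_; _:-_; :-_)

module OrderedCommutativeRingProperties
  {c ℓ₁ ℓ₂} (R : OrderedCommutativeRing c ℓ₁ ℓ₂) where

  open OrderedCommutativeRing R
  open RingProperties ring using (-‿distribˡ-*; -‿involutive; -1*x≈-x)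
  module ≤ = IsTotalOrder isTotalOrder

  poset : Poset c ℓ₁ ℓ₂
  poset = record { isPartialOrder = ≤.isPartialOrder }

  open PosetReasoning poset

  ≤-respˡ-≈ : ∀ {x y z} → x ≈ y → x ≤ z → y ≤ z
  ≤-respˡ-≈ = ≤.≲-respˡ-≈

  +-monoˡ-≤ : ∀ z {x y} → x ≤ y → (z + x) ≤ (z + y)
  +-monoˡ-≤ z {x} {y} x≤y = begin
    z + x  ≈⟨ +-comm z x ⟩
    x + z  ≤⟨ +-mono-≤ z x≤y ⟩
    y + z  ≈⟨ +-comm y z ⟩
    z + y  ∎

  +-nonneg : ∀ {x y} → 0# ≤ x → 0# ≤ y → 0# ≤ (x + y)
  +-nonneg {x} {y} 0≤x 0≤y = begin
    0#      ≤⟨ 0≤x ⟩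
    x       ≈⟨ +-identityʳ x ⟨
    x + 0#  ≤⟨ +-monoˡ-≤ x 0≤y ⟩
    x + y   ∎

  x≤0⇒0≤-x : ∀ {x} → x ≤ 0# → 0# ≤ (- x)
  x≤0⇒0≤-x {x} x≤0 = begin
    0#        ≈⟨ -‿inverseʳ x ⟨
    x + - x   ≤⟨ +-mono-≤ (- x) x≤0 ⟩
    0# + - x  ≈⟨ +-identityˡ (- x) ⟩
    - x       ∎

  0≤x⇒-x≤0 : ∀ {x} → 0# ≤ x → (- x) ≤ 0#
  0≤x⇒-x≤0 {x} 0≤x = begin
    - x       ≈⟨ +-identityˡ (- x) ⟨
    0# + - x  ≤⟨ +-mono-≤ (- x) 0≤x ⟩
    x + - x   ≈⟨ -‿inverseʳ x ⟩
    0#        ∎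

  *-nonpos-nonneg : ∀ {x y} → x ≤ 0# → 0# ≤ y → (x * y) ≤ 0#
  *-nonpos-nonneg {x} {y} x≤0 0≤y = begin
    x * y          ≈⟨ -‿involutive (x * y) ⟨
    - (- (x * y))  ≈⟨ -‿cong (-‿distribˡ-* x y) ⟩
    - (- x * y)    ≤⟨ 0≤x⇒-x≤0 (*-nonneg (x≤0⇒0≤-x x≤0) 0≤y) ⟩
    0#             ∎

  nonneg-+-nonpos⇒≈0 : ∀ {x y} → 0# ≤ x → 0# ≤ y → (x + y) ≤ 0# → x ≈ 0#
  nonneg-+-nonpos⇒≈0 {x} {y} 0≤x 0≤y x+y≤0 = ≤.antisym x≤0 0≤x
    where
    x≤0 : x ≤ 0#
    x≤0 = begin
      x       ≈⟨ +-identityʳ x ⟨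
      x + 0#  ≤⟨ +-monoˡ-≤ x 0≤y ⟩
      x + y   ≤⟨ x+y≤0 ⟩
      0#      ∎

  1≰0 : ¬ (1# ≤ 0#)
  1≰0 1≤0 = nontrivial (≤.antisym 0≤1 1≤0)
    where
    0≤1 : 0# ≤ 1#
    0≤1 = begin
      0#            ≤⟨ *-nonneg (x≤0⇒0≤-x 1≤0) (x≤0⇒0≤-x 1≤0) ⟩
      - 1# * - 1#   ≈⟨ -1*x≈-x (- 1#) ⟩
      - (- 1#)      ≈⟨ -‿involutive 1# ⟩
      1#            ∎

  x≰0⇒0<x : ∀ {x} → ¬ (x ≤ 0#) → 0# < x
  x≰0⇒0<x {x} x≰0 with ≤.total 0# x
  ... | inj₁ 0≤x = NonStrictToStrict.≤∧≉⇒< _≈_ _≤_ 0≤x (λ 0≈x → x≰0 (≤.reflexive (sym 0≈x)))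
  ... | inj₂ x≤0 = contradiction x≤0 x≰0

  0<-respʳ-≈ : ∀ {x y} → x ≈ y → 0# < x → 0# < y
  0<-respʳ-≈ = NonStrictToStrict.<-respʳ-≈ _≈_ _≤_ sym trans ≤.≲-respʳ-≈

module Mat2Properties {c ℓ₁ ℓ₂} (R : OrderedCommutativeRing c ℓ₁ ℓ₂) where

  open OrderedCommutativeRing R
  open Mat2 R
  open OrderedCommutativeRingProperties R
  open IntegerCoefficients commutativeRing using (solve; _:=_; _:+_; _:*_; _:-_; :-_)

  ≋-isEquivalence : IsEquivalence _≋_
  ≋-isEquivalence = record
    { refl  = refl , refl , refl , refl
    ; sym   = λ (p , q , r , s) → sym p , sym q , sym r , sym s
    ; trans = λ (p , q , r , s) (p′ , q′ , r′ , s′) →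
                trans p p′ , trans q q′ , trans r r′ , trans s s′
    }

  ≋-setoid : Setoid c ℓ₁
  ≋-setoid = record { isEquivalence = ≋-isEquivalence }

  open IsEquivalence ≋-isEquivalence public using () renaming (sym to ≋-sym)

  ·-congˡ : ∀ A {B C} → B ≋ C → (A · B) ≋ (A · C)
  ·-congˡ (mat a b c d) (p , q , r , s) =
    row a b p r , row a b q s , row c d p r , row c d q s
    where
    row : ∀ x y {u u′ v v′} → u ≈ u′ → v ≈ v′ → x * u + y * v ≈ x * u′ + y * v′
    row x y u≈u′ v≈v′ = +-cong (*-congˡ u≈u′) (*-congˡ v≈v′)

  ·-assoc : ∀ A B C → ((A · B) · C) ≋ (A · (B · C))
  ·-assoc (mat a₁₁ a₁₂ a₂₁ a₂₂) (mat b₁₁ b₁₂ b₂₁ b₂₂) (mat c₁₁ c₁₂ c₂₁ c₂₂) =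
    entry a₁₁ a₁₂ c₁₁ c₂₁ , entry a₁₁ a₁₂ c₁₂ c₂₂ ,
    entry a₂₁ a₂₂ c₁₁ c₂₁ , entry a₂₁ a₂₂ c₁₂ c₂₂
    where
    entry : ∀ x y u v →
      (x * b₁₁ + y * b₂₁) * u + (x * b₁₂ + y * b₂₂) * v ≈
      x * (b₁₁ * u + b₁₂ * v) + y * (b₂₁ * u + b₂₂ * v)
    entry x y u v = solve 8
      (λ x y u v p q r s →
        (x :* p :+ y :* r) :* u :+ (x :* q :+ y :* s) :* v :=
        x :* (p :* u :+ q :* v) :+ y :* (r :* u :+ s :* v))
      refl x y u v b₁₁ b₁₂ b₂₁ b₂₂

  adj-adj-· : ∀ A B → adj (adj A · B) ≋ (adj B · A)
  adj-adj-· (mat a b c d) (mat w x y z) =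
    solve 4 (λ a c x z → :- c :* x :+ a :* z := z :* a :+ :- x :* c) refl a c x z ,
    solve 4 (λ b d x z → :- (d :* x :+ :- b :* z) := z :* b :+ :- x :* d) refl b d x z ,
    solve 4 (λ a c w y → :- (:- c :* w :+ a :* y) := :- y :* a :+ w :* c) refl a c w y ,
    solve 4 (λ b d w y → d :* w :+ :- b :* y := :- y :* b :+ w :* d) refl b d w y

  module _ {a b c d : Carrier} (det≈1 : det (mat a b c d) ≈ 1#) where

    private
      scaled-by-det : ∀ {u} v → u ≈ (a * d - b * c) * v → u ≈ v
      scaled-by-det v u≈Δv = trans u≈Δv (trans (*-congʳ det≈1) (*-identityˡ v))

    adj-cancelˡ : ∀ B → (adj (mat a b c d) · (mat a b c d · B)) ≋ B
    adj-cancelˡ (mat w x y z) = top w y , top x z , bottom w y , bottom x z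
      where
      top : ∀ u v → d * (a * u + b * v) + - b * (c * u + d * v) ≈ u
      top u v = scaled-by-det u (solve 6
        (λ a b c d u v → d :* (a :* u :+ b :* v) :+ :- b :* (c :* u :+ d :* v) :=
                         (a :* d :- b :* c) :* u)
        refl a b c d u v)
      bottom : ∀ u v → - c * (a * u + b * v) + a * (c * u + d * v) ≈ v
      bottom u v = scaled-by-det v (solve 6
        (λ a b c d u v → :- c :* (a :* u :+ b :* v) :+ a :* (c :* u :+ d :* v) :=
                         (a :* d :- b :* c) :* v)
        refl a b c d u v)

    adj-cancelʳ : ∀ B → (mat a b c d · (adj (mat a b c d) · B)) ≋ B
    adj-cancelʳ (mat w x y z) = top w y , top x z , bottom w y , bottom x z
      where
      top : ∀ u v → a * (d * u + - b * v) + b * (- c * u + a * v) ≈ u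
      top u v = scaled-by-det u (solve 6
        (λ a b c d u v → a :* (d :* u :+ :- b :* v) :+ b :* (:- c :* u :+ a :* v) :=
                         (a :* d :- b :* c) :* u)
        refl a b c d u v)
      bottom : ∀ u v → c * (d * u + - b * v) + d * (- c * u + a * v) ≈ v
      bottom u v = scaled-by-det v (solve 6
        (λ a b c d u v → c :* (d :* u :+ :- b :* v) :+ d :* (:- c :* u :+ a :* v) :=
                         (a :* d :- b :* c) :* v)
        refl a b c d u v)

  ·-nonneg : ∀ {A B} → NonNeg A → NonNeg B → NonNeg (A · B)
  ·-nonneg (0≤a , 0≤b , 0≤c , 0≤d) (0≤w , 0≤x , 0≤y , 0≤z) =
    row 0≤a 0≤b 0≤w 0≤y , row 0≤a 0≤b 0≤x 0≤z , row 0≤c 0≤d 0≤w 0≤y , row 0≤c 0≤d 0≤x 0≤z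
    where
    row : ∀ {p q u v} → 0# ≤ p → 0# ≤ q → 0# ≤ u → 0# ≤ v → 0# ≤ (p * u + q * v)
    row 0≤p 0≤q 0≤u 0≤v = +-nonneg (*-nonneg 0≤p 0≤u) (*-nonneg 0≤q 0≤v)

  -- Row 1 of  A E₁₁ (M B) + (A adj M) E₂₂ B = m₁₁ A B,  an instance of E₁₁ M + (adj M) E₂₂ = m₁₁ I.
  first-row-identity : ∀ A M B →
    (a11 A * a11 (M · B) + a12 (A · adj M) * a21 B ≈ a11 M * a11 (A · B)) ×
    (a11 A * a12 (M · B) + a12 (A · adj M) * a22 B ≈ a11 M * a12 (A · B))
  first-row-identity (mat x y _ _) (mat m n _ _) (mat u₁ v₁ u₂ v₂) =
    column u₁ u₂ , column v₁ v₂
    where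
    column : ∀ u v → x * (m * u + n * v) + (x * - n + y * m) * v ≈ m * (x * u + y * v)
    column u v = solve 6
      (λ x y m n u v → x :* (m :* u :+ n :* v) :+ (x :* :- n :+ y :* m) :* v :=
                       m :* (x :* u :+ y :* v))
      refl x y m n u v

  first-row-annihilator : ∀ {A x} → det A ≈ 1# → x * a11 A ≈ 0# → x * a12 A ≈ 0# → x ≈ 0#
  first-row-annihilator {mat a b c d} {x} det≈1 xa≈0 xb≈0 = begin
    x                          ≈⟨ *-identityʳ x ⟨
    x * 1#                     ≈⟨ *-congˡ det≈1 ⟨
    x * (a * d - b * c)        ≈⟨ solve 5 (λ x a b c d →
                                    x :* (a :* d :- b :* c) := (x :* a) :* d :- (x :* b) :* c)
                                  refl x a b c d ⟩
    (x * a) * d - (x * b) * c  ≈⟨ +-cong (*-congʳ xa≈0) (-‿cong (*-congʳ xb≈0)) ⟩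
    0# * d - 0# * c            ≈⟨ +-cong (zeroˡ d) (-‿cong (zeroˡ c)) ⟩
    0# - 0#                    ≈⟨ -‿inverseʳ 0# ⟩
    0#                         ∎
    where open SetoidReasoning setoid

  a11≈0⇒det≤0 : ∀ {A} → NonNeg A → a11 A ≈ 0# → det A ≤ 0#
  a11≈0⇒det≤0 {mat a b c d} (_ , 0≤b , 0≤c , _) a≈0 =
    ≤-respˡ-≈ (sym det≈-bc) (0≤x⇒-x≤0 (*-nonneg 0≤b 0≤c))
    where
    det≈-bc : a * d - b * c ≈ - (b * c)
    det≈-bc = trans (+-congʳ (trans (*-congʳ a≈0) (zeroˡ d))) (+-identityˡ (- (b * c)))

  adj-·-a11-positive : ∀ α β γ δ → det α ≈ 1# → det γ ≈ 1# → det δ ≈ 1# →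
    NonNeg α → NonNeg β → NonNeg γ → NonNeg δ → (α · β) ≋ (γ · δ) →
    0# < a11 (adj γ · α)
  adj-·-a11-positive α β γ δ detα≈1 detγ≈1 detδ≈1
    α≥0@(α₁₁≥0 , _) β≥0@(_ , _ , β₂₁≥0 , β₂₂≥0) (_ , γ₁₂≥0 , _) (δ₁₁≥0 , δ₁₂≥0 , _) αβ≋γδ =
    x≰0⇒0<x m₁₁≰0
    where
    open SetoidReasoning ≋-setoid

    M : M2
    M = adj γ · α

    δ≋M·β : δ ≋ (M · β)
    δ≋M·β = begin
      δ                ≈⟨ adj-cancelˡ detγ≈1 δ ⟨
      adj γ · (γ · δ)  ≈⟨ ·-congˡ (adj γ) αβ≋γδ ⟨
      adj γ · (α · β)  ≈⟨ ·-assoc (adj γ) α β ⟨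
      M · β            ∎

    γ≋α·adjM : γ ≋ (α · adj M)
    γ≋α·adjM = begin
      γ                ≈⟨ adj-cancelʳ detα≈1 γ ⟨
      α · (adj α · γ)  ≈⟨ ·-congˡ α (adj-adj-· γ α) ⟨
      α · adj M        ∎

    αβ≥0 : NonNeg (α · β)
    αβ≥0 = ·-nonneg α≥0 β≥0

    m₁₁≰0 : ¬ (a11 M ≤ 0#)
    m₁₁≰0 m₁₁≤0 = 1≰0 (≤-respˡ-≈ detα≈1 (a11≈0⇒det≤0 α≥0 α₁₁≈0))
      where
      α₁₁δ₁ⱼ≈0 : ∀ {d b s} → 0# ≤ d → 0# ≤ b → 0# ≤ s →
        a11 α * d + a12 γ * b ≈ a11 M * s → a11 α * d ≈ 0#
      α₁₁δ₁ⱼ≈0 d≥0 b≥0 s≥0 eq = nonneg-+-nonpos⇒≈0 (*-nonneg α₁₁≥0 d≥0) (*-nonneg γ₁₂≥0 b≥0)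
        (≤-respˡ-≈ (sym eq) (*-nonpos-nonneg m₁₁≤0 s≥0))

      γ₁₂≈ : a12 γ ≈ a12 (α · adj M)
      γ₁₂≈ = proj₁ (proj₂ γ≋α·adjM)

      identity₁₁ : a11 α * a11 δ + a12 γ * a21 β ≈ a11 M * a11 (α · β)
      identity₁₁ = trans (+-cong (*-congˡ (proj₁ δ≋M·β)) (*-congʳ γ₁₂≈))
                         (proj₁ (first-row-identity α M β))

      identity₁₂ : a11 α * a12 δ + a12 γ * a22 β ≈ a11 M * a12 (α · β)
      identity₁₂ = trans (+-cong (*-congˡ (proj₁ (proj₂ δ≋M·β))) (*-congʳ γ₁₂≈))
                         (proj₂ (first-row-identity α M β))

      α₁₁≈0 : a11 α ≈ 0#
      α₁₁≈0 = first-row-annihilator detδ≈1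
        (α₁₁δ₁ⱼ≈0 δ₁₁≥0 β₂₁≥0 (proj₁ αβ≥0) identity₁₁)
        (α₁₁δ₁ⱼ≈0 δ₁₂≥0 β₂₂≥0 (proj₁ (proj₂ αβ≥0)) identity₁₂)

mainTheorem5 : ∀ {c ℓ₁ ℓ₂} (R : OrderedCommutativeRing c ℓ₁ ℓ₂) →
    let open OrderedCommutativeRing R
        open Mat2 R
    in (α β γ δ : M2) →
       det α ≈ 1# → det β ≈ 1# → det γ ≈ 1# → det δ ≈ 1# →
       NonNeg α → NonNeg β → NonNeg γ → NonNeg δ →
       (α · β) ≋ (γ · δ) →
       (0# < a11 (adj γ · α)) × (0# < a22 (adj γ · α))
mainTheorem5 R α β γ δ detα≈1 detβ≈1 detγ≈1 detδ≈1 α≥0 β≥0 γ≥0 δ≥0 αβ≋γδ =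
    adj-·-a11-positive α β γ δ detα≈1 detγ≈1 detδ≈1 α≥0 β≥0 γ≥0 δ≥0 αβ≋γδ
  , 0<-respʳ-≈ (proj₁ (≋-sym (adj-adj-· γ α)))
      (adj-·-a11-positive γ δ α β detγ≈1 detα≈1 detβ≈1 γ≥0 δ≥0 α≥0 β≥0 (≋-sym αβ≋γδ))
  where
  open OrderedCommutativeRingProperties R using (0<-respʳ-≈)
  open Mat2Properties R using (adj-·-a11-positive; adj-adj-·; ≋-sym)
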